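{- Let $q=2^m$ where $m$ is a positive integer, let $\omega\in\mathbb{F}_4\setminus\mathbb{F}_2$, and let $h,e\in\mathbb{F}_q\setminus\mathbb{F}_2$ satisfy $h^3=e^2+e+1$. Then for each $\ell\in\{1,2\}$, the polynomial $X^{2q^\ell+1}+hX+e$ has a root in $\mu_{q^2+q+1}$ if and only if $(e+\omega)^{(q^2-1)/3}=\omega^{ -\ell}$, and in that case its roots in $\mu_{q^2+q+1}$ are exactly the three roots of $X^3+h^2X^2+(e+1)hX+1$.
   Context: $\mu_{q^2+q+1}$ denotes the set of $(q^2+q+1)$-th roots of unity in $\mathbb{F}_{q^3}^*$. All fields are viewed inside a fixed algebraic closure of $\mathbb{F}_2$. -}

module Defs where

open import Level using (Level; _⊔_)
open import Data.Nat.Base using (ℕ; suc) renaming (_^_ to _^ℕ_)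
open import Data.Fin.Base using (Fin; toℕ)
open import Data.Product.Base using (∃)
open import Relation.Nullary.Negation using (¬_)
import Algebra.Bundles
open Algebra.Bundles using (CommutativeRing)

module RingPow {c ℓ} (R : CommutativeRing c ℓ) where
  open CommutativeRing R
  open import Algebra.Definitions.RawSemiring (Algebra.Bundles.Semiring.rawSemiring semiring) public
    using (_^_; sum)

  evalMonic : ∀ {n} → (Fin n → Carrier) → Carrier → Carrier
  evalMonic {n} a x = x ^ n + sum (λ i → a i * x ^ toℕ i)

-- R is (a model of) an algebraic closure of F₂:
-- a field of characteristic 2, algebraically closed, and algebraic over F₂
-- (every element lies in some finite field F_{2^(n+1)}, i.e. x^(2^(n+1)) = x).
record IsAlgClosureF2 {c ℓ} (R : CommutativeRing c ℓ) : Set (c ⊔ ℓ) where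
  open CommutativeRing R
  open RingPow R
  field
    nontrivial  : ¬ (0# ≈ 1#)
    inverses    : ∀ x → ¬ (x ≈ 0#) → ∃ λ y → x * y ≈ 1#
    char2       : 1# + 1# ≈ 0#
    algClosed   : ∀ n (a : Fin (suc n) → Carrier) → ∃ λ x → evalMonic a x ≈ 0#
    algebraic   : ∀ x → ∃ λ n → x ^ (2 ^ℕ suc n) ≈ x

{-# OPTIONS --safe #-}
module Submission where

-- Let σ x = x ^ q with q = 2 ^ m, pick U with U³ = e + ω and put V = h / U, so that U V = h
-- and V³ = e + ω².  Then the cubic X³ + h²X² + (e+1)hX + 1 is ∏_b (X + e (b U + b² V) + h²)
-- over the cube roots of unity b.  If x ∈ μ solves X^(2q^l+1) + hX + e, then x, σ^l x, σ^2l x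
-- solve a cyclic system whose elementary symmetric functions are those of the cubic, so x is
-- one of its roots.  Now σ² U = a⁻¹ U for a cube root of unity a, σ sends the root indexed by
-- b to the one indexed by a b, and (e + ω)^((q²-1)/3) = U^(q²-1) = a⁻¹, so the criterion says
-- a = ω^l.  The roots of the cubic are solutions when a = ω^l; when a = 1 they are fixed by σ,
-- and when a = ω^(3-l) they solve the equation for the other exponent, and neither is possible
-- for a solution.  Equality is ¬¬-stable in an algebraic extension of F₂, which lets all case
-- distinctions on the vanishing of products be made constructively.

open import Defs
open import Data.Nat.Base using (ℕ; _≤_; _∸_; _/_) renaming (_^_ to _^ℕ_; _+_ to _+ℕ_; _*_ to _*ℕ_)
open import Data.Product.Base using (∃; _×_; _,_; proj₁; proj₂)
open import Data.Sum.Base using (_⊎_; inj₁; inj₂; [_,_]′)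
open import Relation.Nullary.Negation using (¬_)
open import Relation.Binary.PropositionalEquality using (_≡_)
open import Function.Bundles using (_⇔_; mk⇔; module Equivalence)
open import Algebra.Bundles using (CommutativeRing)

import Algebra.Properties.Semiring.Mult as Mult
import Algebra.Properties.Semiring.Exp as Exp
import Algebra.Properties.CommutativeSemiring.Exp as CExp
import Data.Nat.Base as ℕ
import Data.Nat.Properties as ℕ
import Data.Nat.DivMod as DivMod
import Relation.Binary.PropositionalEquality as ≡
open import Data.Empty using (⊥; ⊥-elim)
import Data.Fin.Base as Fin
open import Data.Maybe.Base as Maybe using (Maybe; just; nothing; From-just; from-just)
open import Data.Vec.N-ary using (N-ary; Eq; curryⁿ; curryⁿ-cong; Eq-to-Eqʰ)
open import Relation.Nullary.Decidable using (yes; no)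
open import Data.Nat.Solver using (module +-*-Solver)

2^m*2^m≡1+k*3 : ∀ m → ∃ λ k → 2 ^ℕ m *ℕ 2 ^ℕ m ≡ ℕ.suc (k *ℕ 3)
2^m*2^m≡1+k*3 ℕ.zero = 0 , ≡.refl
2^m*2^m≡1+k*3 (ℕ.suc m) with 2^m*2^m≡1+k*3 m
... | k , q*q≡1+k*3 = ℕ.suc (4 *ℕ k) , (begin
  2 *ℕ q *ℕ (2 *ℕ q)          ≡⟨ solve 1 (λ q → con 2 :* q :* (con 2 :* q) := con 4 :* (q :* q)) ≡.refl q ⟩
  4 *ℕ (q *ℕ q)               ≡⟨ ≡.cong (4 *ℕ_) q*q≡1+k*3 ⟩
  4 *ℕ ℕ.suc (k *ℕ 3)         ≡⟨ solve 1 (λ k → con 4 :* (con 1 :+ k :* con 3)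
                                             := con 1 :+ (con 1 :+ con 4 :* k) :* con 3) ≡.refl k ⟩
  ℕ.suc (ℕ.suc (4 *ℕ k) *ℕ 3) ∎)
  where
  q : ℕ
  q = 2 ^ℕ m
  open ≡.≡-Reasoning
  open +-*-Solver

data OneOrTwo : Set where
  one two : OneOrTwo

toℕ : OneOrTwo → ℕ
toℕ one = 1
toℕ two = 2

module _ {c ℓ} (R : CommutativeRing c ℓ) where

  open CommutativeRing R
  open RingPow R using (_^_)
  open Exp semiring using (^-congˡ; ^-congʳ; ^-homo-*; ^-assocʳ)
  open CExp commutativeSemiring using (^-distrib-*)

  cubic : Carrier → Carrier → Carrier → Carrier
  cubic h e x = x ^ 3 + h ^ 2 * x ^ 2 + (e + 1#) * h * x + 1#

  twisted : Carrier → Carrier → Carrier → Carrier → Carrier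
  twisted h e x y = x * y ^ 2 + h * x + e

  twisted-cong : ∀ {h e x x′ y y′} → x ≈ x′ → y ≈ y′ → twisted h e x y ≈ twisted h e x′ y′
  twisted-cong x≈x′ y≈y′ = +-congʳ (+-cong (*-cong x≈x′ (^-congˡ 2 y≈y′)) (*-congˡ x≈x′))

  *-≈0 : ∀ {x r} → r ≈ 0# → x * r ≈ 0#
  *-≈0 {x} r≈0 = trans (*-congˡ r≈0) (zeroʳ x)

  +-≈0 : ∀ {a b} → a ≈ 0# → b ≈ 0# → a + b ≈ 0#
  +-≈0 a≈0 b≈0 = trans (+-cong a≈0 b≈0) (+-identityʳ 0#)

  modulo : ∀ {a b r} → a ≈ b + r → r ≈ 0# → a ≈ b
  modulo {b = b} a≈b+r r≈0 = trans a≈b+r (trans (+-congˡ r≈0) (+-identityʳ b))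

  1#^ : ∀ n → 1# ^ n ≈ 1#
  1#^ ℕ.zero = refl
  1#^ (ℕ.suc n) = trans (*-identityˡ _) (1#^ n)

  cube-of-product : ∀ {a b} → a ^ 3 ≈ 1# → b ^ 3 ≈ 1# → (a * b) ^ 3 ≈ 1#
  cube-of-product {a} {b} a³≈1 b³≈1 = trans (^-distrib-* a b 3) (trans (*-cong a³≈1 b³≈1) (*-identityˡ 1#))

  module Char2 (char2 : 1# + 1# ≈ 0#) where

    open Mult semiring using () renaming (_×_ to _·1_)
    open import Relation.Binary.Reasoning.Setoid setoid

    parity : ℕ → ℕ
    parity ℕ.zero = 0
    parity (ℕ.suc ℕ.zero) = 1
    parity (ℕ.suc (ℕ.suc n)) = parity n

    ·1≈parity·1 : ∀ n → n ·1 1# ≈ parity n ·1 1#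
    ·1≈parity·1 ℕ.zero = refl
    ·1≈parity·1 (ℕ.suc ℕ.zero) = refl
    ·1≈parity·1 (ℕ.suc (ℕ.suc n)) = begin
      1# + (1# + n ·1 1#) ≈⟨ +-assoc 1# 1# _ ⟨
      (1# + 1#) + n ·1 1# ≈⟨ +-congʳ char2 ⟩
      0# + n ·1 1#        ≈⟨ +-identityˡ _ ⟩
      n ·1 1#             ≈⟨ ·1≈parity·1 n ⟩
      parity n ·1 1#      ∎

    -- Coefficients are compared modulo 2, so the ring solver decides identities in characteristic 2.
    coefficient≟ : ∀ m n → Maybe (m ·1 1# ≈ n ·1 1#)
    coefficient≟ m n with parity m ℕ.≟ parity n
    ... | yes p = just (trans (·1≈parity·1 m) (trans (reflexive (≡.cong (_·1 1#) p)) (sym (·1≈parity·1 n))))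
    ... | no _  = nothing

    open import Algebra.Solver.Ring.NaturalCoefficients commutativeSemiring coefficient≟ public
      hiding (solve)
    open import Relation.Binary.Reflection setoid var ⟦_⟧ ⟦_⟧↓ correct using (close; solve)

    normal-forms-agree : ∀ n (f : N-ary n (Polynomial n) (Polynomial n × Polynomial n)) →
      normalise (proj₁ (close n f)) ≈N normalise (proj₂ (close n f)) →
      Eq n _≈_ (curryⁿ ⟦ proj₁ (close n f) ⟧) (curryⁿ ⟦ proj₂ (close n f) ⟧)
    normal-forms-agree n f eq = solve n f (Eq-to-Eqʰ n _≈_ (curryⁿ-cong _≈_ _ _ ⟦ eq ⟧N-cong))

    -- The type reduces to the n-ary equation exactly when the normal forms agree.
    solve₂ : ∀ n (f : N-ary n (Polynomial n) (Polynomial n × Polynomial n)) →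
             From-just (Maybe.map (normal-forms-agree n f)
                                  (normalise (proj₁ (close n f)) ≟N normalise (proj₂ (close n f))))
    solve₂ n f = from-just (Maybe.map (normal-forms-agree n f)
                                      (normalise (proj₁ (close n f)) ≟N normalise (proj₂ (close n f))))

    x+x≈0 : ∀ x → x + x ≈ 0#
    x+x≈0 = solve₂ 1 (λ x → x :+ x := con 0)

    ≈⇒+≈0 : ∀ {a b} → a ≈ b → a + b ≈ 0#
    ≈⇒+≈0 {a} {b} a≈b = trans (+-congʳ a≈b) (x+x≈0 b)

    +≈0⇒≈ : ∀ {a b} → a + b ≈ 0# → a ≈ b
    +≈0⇒≈ {a} {b} a+b≈0 = begin
      a            ≈⟨ solve₂ 2 (λ a b → a := (a :+ b) :+ b) a b ⟩
      (a + b) + b  ≈⟨ +-congʳ a+b≈0 ⟩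
      0# + b       ≈⟨ +-identityˡ b ⟩
      b            ∎

    multiple : ∀ {x a b} → a ≈ b → x * (a + b) ≈ 0#
    multiple {x} a≈b = trans (*-congˡ (≈⇒+≈0 a≈b)) (zeroʳ x)

    vieta : ∀ {x y z s₁ s₂ s₃} → x + y + z ≈ s₁ → x * y + y * z + z * x ≈ s₂ → x * y * z ≈ s₃ →
            x ^ 3 + s₁ * x ^ 2 + s₂ * x + s₃ ≈ 0#
    vieta {x} {y} {z} {s₁} {s₂} {s₃} e₁ e₂ e₃ = trans
      (solve₂ 6 (λ x y z s₁ s₂ s₃ → x :^ 3 :+ s₁ :* x :^ 2 :+ s₂ :* x :+ s₃
                  := x :^ 2 :* (x :+ y :+ z :+ s₁) :+ x :* (x :* y :+ y :* z :+ z :* x :+ s₂)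
                     :+ con 1 :* (x :* y :* z :+ s₃)) x y z s₁ s₂ s₃)
      (+-≈0 (+-≈0 (multiple e₁) (multiple e₂)) (multiple e₃))

    cube-root-of-unity-inverse : ∀ {t x y} → t ^ 3 ≈ 1# → t * x ≈ y → x ≈ t ^ 2 * y
    cube-root-of-unity-inverse {t} {x} {y} t³≈1 tx≈y = modulo
      (solve₂ 3 (λ t x y → x := t :^ 2 :* y :+ (t :^ 2 :* (t :* x :+ y) :+ x :* (t :^ 3 :+ con 1))) t x y)
      (+-≈0 (multiple tx≈y) (multiple t³≈1))

  module Char2Field (char2 : 1# + 1# ≈ 0#)
                    (inverses : ∀ x → ¬ x ≈ 0# → ∃ λ y → x * y ≈ 1#) where

    open Char2 char2
    open import Relation.Binary.Reasoning.Setoid setoid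

    *-cancelˡ-≈0 : ∀ {u r} → ¬ u ≈ 0# → u * r ≈ 0# → r ≈ 0#
    *-cancelˡ-≈0 {u} {r} u≉0 ur≈0 with inverses u u≉0
    ... | v , uv≈1 = begin
      r                               ≈⟨ solve₂ 3 (λ u v r → r := r :* (con 1 :+ u :* v) :+ v :* (u :* r)) u v r ⟩
      r * (1# + u * v) + v * (u * r)  ≈⟨ +-≈0 (multiple (sym uv≈1)) (*-≈0 ur≈0) ⟩
      0#                              ∎

    *-cancelˡ : ∀ {u a b} → ¬ u ≈ 0# → u * a ≈ u * b → a ≈ b
    *-cancelˡ {u} {a} {b} u≉0 ua≈ub =
      +≈0⇒≈ (*-cancelˡ-≈0 u≉0 (trans (distribˡ u a b) (≈⇒+≈0 ua≈ub)))

    *-≉0 : ∀ {a b} → ¬ a ≈ 0# → ¬ b ≈ 0# → ¬ a * b ≈ 0#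
    *-≉0 a≉0 b≉0 ab≈0 = b≉0 (*-cancelˡ-≈0 a≉0 ab≈0)

    *≈0⇒¬¬ : ∀ {a b} → a * b ≈ 0# → ¬ ¬ (a ≈ 0# ⊎ b ≈ 0#)
    *≈0⇒¬¬ ab≈0 k = k (inj₂ (*-cancelˡ-≈0 (λ a≈0 → k (inj₁ a≈0)) ab≈0))

    *₃≈0⇒¬¬ : ∀ {a b d} → a * b * d ≈ 0# → ¬ ¬ (a ≈ 0# ⊎ b ≈ 0# ⊎ d ≈ 0#)
    *₃≈0⇒¬¬ abd≈0 k = *≈0⇒¬¬ abd≈0 λ
      { (inj₁ ab≈0) → *≈0⇒¬¬ ab≈0 λ { (inj₁ a≈0) → k (inj₁ a≈0) ; (inj₂ b≈0) → k (inj₂ (inj₁ b≈0)) }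
      ; (inj₂ d≈0) → k (inj₂ (inj₂ d≈0)) }

    ^-≉0 : ∀ {x} → ¬ x ≈ 0# → ∀ n → ¬ x ^ n ≈ 0#
    ^-≉0 x≉0 ℕ.zero 1≈0 = x≉0 (trans (sym (*-identityʳ _)) (*-≈0 1≈0))
    ^-≉0 x≉0 (ℕ.suc n) = *-≉0 x≉0 (^-≉0 x≉0 n)

    primitive-cube-root : ∀ {ω} → ω ^ 4 ≈ ω → ¬ ω ≈ 0# → ¬ ω ≈ 1# → ω ^ 2 + ω + 1# ≈ 0#
    primitive-cube-root {ω} ω⁴≈ω ω≉0 ω≉1 =
      *-cancelˡ-≈0 (λ ω+1≈0 → ω≉1 (+≈0⇒≈ ω+1≈0)) (*-cancelˡ-≈0 ω≉0 (trans
        (solve₂ 1 (λ ω → ω :* ((ω :+ con 1) :* (ω :^ 2 :+ ω :+ con 1)) := ω :^ 4 :+ ω) ω)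
        (≈⇒+≈0 ω⁴≈ω)))

    equal-cubes : ∀ {X Y} → ¬ Y ≈ 0# → X ^ 3 ≈ Y ^ 3 → ∃ λ t → t ^ 3 ≈ 1# × X ≈ t * Y
    equal-cubes {X} {Y} Y≉0 X³≈Y³ with inverses Y Y≉0
    ... | Y⁻¹ , YY⁻¹≈1 = X * Y⁻¹ , t³≈1 , X≈tY
      where
      t³≈1 : (X * Y⁻¹) ^ 3 ≈ 1#
      t³≈1 = begin
        (X * Y⁻¹) ^ 3      ≈⟨ ^-distrib-* X Y⁻¹ 3 ⟩
        X ^ 3 * Y⁻¹ ^ 3    ≈⟨ *-congʳ X³≈Y³ ⟩
        Y ^ 3 * Y⁻¹ ^ 3    ≈⟨ ^-distrib-* Y Y⁻¹ 3 ⟨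
        (Y * Y⁻¹) ^ 3      ≈⟨ ^-congˡ 3 YY⁻¹≈1 ⟩
        1# ^ 3             ≈⟨ 1#^ 3 ⟩
        1#                 ∎
      X≈tY : X ≈ X * Y⁻¹ * Y
      X≈tY = begin
        X                  ≈⟨ *-identityʳ X ⟨
        X * 1#             ≈⟨ *-congˡ YY⁻¹≈1 ⟨
        X * (Y * Y⁻¹)      ≈⟨ solve₂ 3 (λ X Y Z → X :* (Y :* Z) := X :* Z :* Y) X Y Y⁻¹ ⟩
        X * Y⁻¹ * Y        ∎

  module AlgebraicOverF₂ (A : IsAlgClosureF2 R) where

    open IsAlgClosureF2 A
    open Char2 char2
    open Char2Field char2 inverses
    open import Relation.Binary.Reasoning.Setoid setoid

    2^suc≡2+ : ∀ n → 2 ^ℕ ℕ.suc n ≡ 2 +ℕ 2 *ℕ ℕ.pred (2 ^ℕ n)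
    2^suc≡2+ n = ≡.trans (≡.cong (2 *ℕ_) (≡.sym (ℕ.suc-pred (2 ^ℕ n) {{ℕ.m^n≢0 2 n}})))
                         (ℕ.*-suc 2 (ℕ.pred (2 ^ℕ n)))

    periodic : ∀ x → ∃ λ j → x ^ (2 +ℕ j) ≈ x
    periodic x with algebraic x
    ... | n , x^2^n≈x = 2 *ℕ ℕ.pred (2 ^ℕ n) , trans (^-congʳ x (≡.sym (2^suc≡2+ n))) x^2^n≈x

    x*x≈0⇒x≈0 : ∀ {x} → x * x ≈ 0# → x ≈ 0#
    x*x≈0⇒x≈0 {x} xx≈0 with periodic x
    ... | j , x^[2+j]≈x = begin
      x                 ≈⟨ x^[2+j]≈x ⟨
      x * (x * x ^ j)   ≈⟨ *-assoc x x (x ^ j) ⟨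
      x * x * x ^ j     ≈⟨ trans (*-congʳ xx≈0) (zeroˡ _) ⟩
      0#                ∎

    -- E = x ^ (2ⁿ - 1) is idempotent with x E = x; E ≈ 1 would refute x ≈ 0, so 1 + E ≉ 0 and
    -- E (1 + E) = 0 gives E ≈ 0.
    ≈0-stable : ∀ {x} → ¬ ¬ (x ≈ 0#) → x ≈ 0#
    ≈0-stable {x} ¬¬x≈0 with periodic x
    ... | j , x^[2+j]≈x = x≈0
      where
      E : Carrier
      E = x ^ ℕ.suc j
      EE≈E : E * E ≈ E
      EE≈E = begin
        E * E                       ≈⟨ ^-homo-* x (ℕ.suc j) (ℕ.suc j) ⟨
        x ^ (ℕ.suc j +ℕ ℕ.suc j)    ≈⟨ ^-congʳ x (≡.sym (ℕ.+-suc j (ℕ.suc j))) ⟩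
        x ^ (j +ℕ (2 +ℕ j))         ≈⟨ ^-homo-* x j (2 +ℕ j) ⟩
        x ^ j * x ^ (2 +ℕ j)        ≈⟨ *-congˡ x^[2+j]≈x ⟩
        x ^ j * x                   ≈⟨ *-comm (x ^ j) x ⟩
        E                           ∎
      1+E≉0 : ¬ (1# + E ≈ 0#)
      1+E≉0 1+E≈0 = ¬¬x≈0 λ x≈0 → nontrivial (begin
        0#       ≈⟨ trans (*-congʳ x≈0) (zeroˡ _) ⟨
        x * x ^ j ≈⟨ +≈0⇒≈ 1+E≈0 ⟨
        1#       ∎)
      E≈0 : E ≈ 0#
      E≈0 = *-cancelˡ-≈0 1+E≉0 (trans (distribʳ E 1# E) (trans (+-cong (*-identityˡ E) EE≈E) (x+x≈0 E)))
      x≈0 : x ≈ 0#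
      x≈0 = begin
        x         ≈⟨ x^[2+j]≈x ⟨
        x * E     ≈⟨ *-≈0 E≈0 ⟩
        0#        ∎

    X³+_ : Carrier → Fin.Fin 3 → Carrier
    (X³+ a) Fin.zero = a
    (X³+ a) (Fin.suc _) = 0#

    cube-root : ∀ a → ∃ λ x → x ^ 3 ≈ a
    cube-root a with algClosed 2 (X³+ a)
    ... | x , root = x , +≈0⇒≈ (trans
      (solve₂ 2 (λ x a → x :^ 3 :+ a := x :^ 3 :+ (a :* con 1 :+ (con 0 :* x :^ 1 :+ (con 0 :* x :^ 2 :+ con 0)))) x a)
      root)

    ≈-stable : ∀ {a b} → ¬ ¬ (a ≈ b) → a ≈ b
    ≈-stable ¬¬a≈b = +≈0⇒≈ (≈0-stable λ k → ¬¬a≈b λ a≈b → k (≈⇒+≈0 a≈b))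

  module PowersOfTwo (char2 : 1# + 1# ≈ 0#) where

    open Char2 char2
    open import Relation.Binary.Reasoning.Setoid setoid

    ^2^suc : ∀ m x → x ^ (2 ^ℕ ℕ.suc m) ≈ (x ^ (2 ^ℕ m)) ^ 2
    ^2^suc m x = trans (^-congʳ x (ℕ.*-comm 2 (2 ^ℕ m))) (sym (^-assocʳ x (2 ^ℕ m) 2))

    ^2^-distrib-+ : ∀ m x y → (x + y) ^ (2 ^ℕ m) ≈ x ^ (2 ^ℕ m) + y ^ (2 ^ℕ m)
    ^2^-distrib-+ ℕ.zero x y = solve₂ 2 (λ x y → (x :+ y) :^ 1 := x :^ 1 :+ y :^ 1) x y
    ^2^-distrib-+ (ℕ.suc m) x y = begin
      (x + y) ^ (2 ^ℕ ℕ.suc m)                        ≈⟨ ^2^suc m (x + y) ⟩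
      ((x + y) ^ (2 ^ℕ m)) ^ 2                        ≈⟨ ^-congˡ 2 (^2^-distrib-+ m x y) ⟩
      (x ^ (2 ^ℕ m) + y ^ (2 ^ℕ m)) ^ 2               ≈⟨ solve₂ 2 (λ a b → (a :+ b) :^ 2 := a :^ 2 :+ b :^ 2) _ _ ⟩
      (x ^ (2 ^ℕ m)) ^ 2 + (y ^ (2 ^ℕ m)) ^ 2         ≈⟨ +-cong (^2^suc m x) (^2^suc m y) ⟨
      x ^ (2 ^ℕ ℕ.suc m) + y ^ (2 ^ℕ ℕ.suc m)         ∎

    ^2^-on-cube-roots-of-unity : ∀ m → (∀ t → t ^ 3 ≈ 1# → t ^ (2 ^ℕ m) ≈ t)
                                     ⊎ (∀ t → t ^ 3 ≈ 1# → t ^ (2 ^ℕ m) ≈ t ^ 2)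
    ^2^-on-cube-roots-of-unity ℕ.zero = inj₁ λ t _ → *-identityʳ t
    ^2^-on-cube-roots-of-unity (ℕ.suc m) with ^2^-on-cube-roots-of-unity m
    ... | inj₁ fixes   = inj₂ λ t t³≈1 → trans (^2^suc m t) (^-congˡ 2 (fixes t t³≈1))
    ... | inj₂ squares = inj₁ λ t t³≈1 → begin
      t ^ (2 ^ℕ ℕ.suc m)      ≈⟨ ^2^suc m t ⟩
      (t ^ (2 ^ℕ m)) ^ 2      ≈⟨ ^-congˡ 2 (squares t t³≈1) ⟩
      (t ^ 2) ^ 2             ≈⟨ modulo (solve₂ 1 (λ t → (t :^ 2) :^ 2 := t :+ t :* (t :^ 3 :+ con 1)) t) (multiple t³≈1) ⟩
      t                       ∎

  module PrimitiveCubeRoot (char2 : 1# + 1# ≈ 0#)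
                           {ω : Carrier} (ω²+ω+1≈0 : ω ^ 2 + ω + 1# ≈ 0#) where

    open Char2 char2

    ω³≈1 : ω ^ 3 ≈ 1#
    ω³≈1 = modulo (solve₂ 1 (λ ω → ω :^ 3 := con 1 :+ (ω :+ con 1) :* (ω :^ 2 :+ ω :+ con 1)) ω)
                  (*-≈0 ω²+ω+1≈0)

    norm : ∀ x → (x + ω) * (x + ω ^ 2) ≈ x ^ 2 + x + 1#
    norm x = modulo (solve₂ 2 (λ x ω → (x :+ ω) :* (x :+ ω :^ 2)
                                 := x :^ 2 :+ x :+ con 1 :+ (x :+ ω :+ con 1) :* (ω :^ 2 :+ ω :+ con 1)) x ω)
                    (*-≈0 ω²+ω+1≈0)

    cube-roots-of-unity : ∀ t → t ^ 3 + 1# ≈ (t + 1#) * (t + ω) * (t + ω ^ 2)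
    cube-roots-of-unity t =
      modulo (solve₂ 2 (λ t ω → t :^ 3 :+ con 1
                                := (t :+ con 1) :* (t :+ ω) :* (t :+ ω :^ 2)
                                   :+ (t :^ 2 :+ ω :* t :+ ω :+ con 1) :* (ω :^ 2 :+ ω :+ con 1)) t ω)
             (*-≈0 ω²+ω+1≈0)

  module CardanoRoots (char2 : 1# + 1# ≈ 0#)
                      {ω : Carrier} (ω²+ω+1≈0 : ω ^ 2 + ω + 1# ≈ 0#)
                      {e h U V : Carrier} (UV≈h : U * V ≈ h)
                      (U³≈e+ω : U ^ 3 ≈ e + ω) (V³≈e+ω² : V ^ 3 ≈ e + ω ^ 2) where

    open Char2 char2
    open PrimitiveCubeRoot char2 ω²+ω+1≈0 using (norm)
    open import Relation.Binary.Reasoning.Setoid setoid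

    root : Carrier → Carrier
    root b = e * (b * U + b ^ 2 * V) + h ^ 2

    root-cong : ∀ {b c} → b ≈ c → root b ≈ root c
    root-cong b≈c = +-congʳ (*-congˡ (+-cong (*-congʳ b≈c) (*-congʳ (^-congˡ 2 b≈c))))

    h³≈e²+e+1 : h ^ 3 ≈ e ^ 2 + e + 1#
    h³≈e²+e+1 = begin
      h ^ 3                      ≈⟨ ^-congˡ 3 UV≈h ⟨
      (U * V) ^ 3                ≈⟨ ^-distrib-* U V 3 ⟩
      U ^ 3 * V ^ 3              ≈⟨ *-cong U³≈e+ω V³≈e+ω² ⟩
      (e + ω) * (e + ω ^ 2)      ≈⟨ norm e ⟩
      e ^ 2 + e + 1#             ∎

    conjugate-roots : ∀ {a} → a ^ 2 + a + 1# ≈ 0# → ∀ X →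
      (X + root a) * (X + root (a ^ 2))
        ≈ (X + h ^ 2) ^ 2 + (X + h ^ 2) * (e * (U + V)) + e ^ 2 * (U ^ 2 + U * V + V ^ 2)
    conjugate-roots {a} a²+a+1≈0 X = modulo
      (solve₂ 6 (λ X h e U V a →
        let Y = X :+ h :^ 2 ; A = e :* U ; B = e :* V ; r = a :^ 2 :+ a :+ con 1 in
        (X :+ (e :* (a :* U :+ a :^ 2 :* V) :+ h :^ 2))
          :* (X :+ (e :* (a :^ 2 :* U :+ (a :^ 2) :^ 2 :* V) :+ h :^ 2))
        := Y :^ 2 :+ Y :* (e :* (U :+ V)) :+ e :^ 2 :* (U :^ 2 :+ U :* V :+ V :^ 2)
           :+ (Y :* A :+ Y :* B :* r :+ A :^ 2 :* (a :+ con 1) :+ A :* B :* (a :^ 3 :+ a :+ con 1)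
               :+ B :^ 2 :* (a :+ con 1) :^ 2 :* r) :* r) X h e U V a)
      (*-≈0 a²+a+1≈0)

    cubic-factorisation : ∀ {a} → a ^ 2 + a + 1# ≈ 0# → ∀ X →
      cubic h e X ≈ (X + root 1#) * (X + root a) * (X + root (a ^ 2))
    cubic-factorisation {a} a²+a+1≈0 X = begin
      cubic h e X
        ≈⟨ modulo (solve₂ 6 (λ X h e U V ω →
             let Y = X :+ h :^ 2 ; e³ = e :^ 3 in
             X :^ 3 :+ h :^ 2 :* X :^ 2 :+ (e :+ con 1) :* h :* X :+ con 1
             := (X :+ (e :* (con 1 :* U :+ con 1 :^ 2 :* V) :+ h :^ 2))
                  :* (Y :^ 2 :+ Y :* (e :* (U :+ V)) :+ e :^ 2 :* (U :^ 2 :+ U :* V :+ V :^ 2))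
                :+ (e :^ 2 :* Y :* (U :* V :+ h)
                    :+ e³ :* (U :^ 3 :+ (e :+ ω)) :+ e³ :* (V :^ 3 :+ (e :+ ω :^ 2))
                    :+ e³ :* (ω :^ 2 :+ ω :+ con 1)
                    :+ (h :^ 3 :+ e :+ con 1 :+ h :* X) :* (h :^ 3 :+ (e :^ 2 :+ e :+ con 1)))) X h e U V ω)
             (+-≈0 (+-≈0 (+-≈0 (+-≈0 (multiple UV≈h) (multiple U³≈e+ω)) (multiple V³≈e+ω²))
                          (*-≈0 ω²+ω+1≈0))
                    (multiple h³≈e²+e+1)) ⟩
      (X + root 1#) * ((X + h ^ 2) ^ 2 + (X + h ^ 2) * (e * (U + V)) + e ^ 2 * (U ^ 2 + U * V + V ^ 2))
        ≈⟨ *-congˡ (conjugate-roots a²+a+1≈0 X) ⟨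
      (X + root 1#) * ((X + root a) * (X + root (a ^ 2)))
        ≈⟨ *-assoc _ _ _ ⟨
      (X + root 1#) * (X + root a) * (X + root (a ^ 2)) ∎

    -- After expanding, substitute U V = h, U³ = e + ω, V³ = e + ω² and reduce by ω² + ω + 1 = 0:
    -- what is left is a multiple of h³ + e² + e + 1.
    twisted-root : twisted h e (root 1#) (root ω) ≈ 0#
    twisted-root = trans
      (solve₂ 5 (λ h e U V ω →
        let x₀ = e :* (con 1 :* U :+ con 1 :^ 2 :* V) :+ h :^ 2
            x₁ = e :* (ω :* U :+ ω :^ 2 :* V) :+ h :^ 2
            s = U :+ V in
        x₀ :* x₁ :^ 2 :+ h :* x₀ :+ e
        := (e :^ 2 :* h :* (ω :^ 2 :* U :^ 2 :+ ω :* V :^ 2) :+ e :^ 3 :* (ω :^ 2 :* U :+ ω :* V))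
                :* (U :* V :+ h)
           :+ e :^ 2 :* ω :^ 2 :* (h :* V :+ e) :* (U :^ 3 :+ (e :+ ω))
           :+ e :^ 2 :* ω :* (h :* U :+ e) :* (V :^ 3 :+ (e :+ ω :^ 2))
           :+ ((ω :+ con 1) :* (ω :* e :^ 2 :* V :^ 2 :* x₀ :+ h :* e :^ 2 :* s) :+ e :^ 3 :* (h :* s :+ e))
                :* (ω :^ 2 :+ ω :+ con 1)
           :+ (h :^ 3 :+ e :^ 2 :+ e :+ e :* h :* s) :* (h :^ 3 :+ (e :^ 2 :+ e :+ con 1))) h e U V ω)
      (+-≈0 (+-≈0 (+-≈0 (+-≈0 (multiple UV≈h) (multiple U³≈e+ω)) (multiple V³≈e+ω²)) (*-≈0 ω²+ω+1≈0))
            (multiple h³≈e²+e+1))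

    rotated-UV≈h : ∀ {b} → b ^ 3 ≈ 1# → b * U * (b ^ 2 * V) ≈ h
    rotated-UV≈h {b} b³≈1 = trans
      (modulo (solve₂ 3 (λ b U V → b :* U :* (b :^ 2 :* V) := U :* V :+ U :* V :* (b :^ 3 :+ con 1)) b U V)
              (multiple b³≈1))
      UV≈h

    rotated-U³ : ∀ {b} → b ^ 3 ≈ 1# → (b * U) ^ 3 ≈ e + ω
    rotated-U³ {b} b³≈1 = trans
      (modulo (solve₂ 2 (λ b U → (b :* U) :^ 3 := U :^ 3 :+ U :^ 3 :* (b :^ 3 :+ con 1)) b U) (multiple b³≈1))
      U³≈e+ω

    rotated-V³ : ∀ {b} → b ^ 3 ≈ 1# → (b ^ 2 * V) ^ 3 ≈ e + ω ^ 2
    rotated-V³ {b} b³≈1 = trans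
      (modulo (solve₂ 2 (λ b V → (b :^ 2 :* V) :^ 3 := V :^ 3 :+ V :^ 3 :* (b :^ 3 :+ con 1) :* (b :^ 3 :+ con 1)) b V)
              (multiple b³≈1))
      V³≈e+ω²

    root-of-rotated : ∀ b c → e * (c * (b * U) + c ^ 2 * (b ^ 2 * V)) + h ^ 2 ≈ root (c * b)
    root-of-rotated b c = solve₂ 6 (λ b c e h U V → e :* (c :* (b :* U) :+ c :^ 2 :* (b :^ 2 :* V)) :+ h :^ 2
                                                   := e :* (c :* b :* U :+ (c :* b) :^ 2 :* V) :+ h :^ 2) b c e h U V

  module CyclicSystem (char2 : 1# + 1# ≈ 0#)
                      (inverses : ∀ x → ¬ x ≈ 0# → ∃ λ y → x * y ≈ 1#)
                      {h e : Carrier} (h≉0 : ¬ h ≈ 0#) (e≉0 : ¬ e ≈ 0#)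
                      (h³≈e²+e+1 : h ^ 3 ≈ e ^ 2 + e + 1#) where

    open Char2 char2
    open Char2Field char2 inverses

    cyclic-solution-is-root : ∀ {x y z} →
      twisted h e x y ≈ 0# → twisted h e y z ≈ 0# → twisted h e z x ≈ 0# → x * y * z ≈ 1# →
      cubic h e x ≈ 0#
    cyclic-solution-is-root {x} {y} {z} t₁ t₂ t₃ xyz≈1 = vieta s₁≈h² s₂≈[e+1]h xyz≈1
      where
      s₁ s₂ : Carrier
      s₁ = x + y + z
      s₂ = x * y + y * z + z * x
      linear : (e + 1#) * s₁ + h * s₂ ≈ 0#
      linear = trans
        (solve₂ 5 (λ x y z h e →
          (e :+ con 1) :* (x :+ y :+ z) :+ h :* (x :* y :+ y :* z :+ z :* x)
          := z :* (x :* y :^ 2 :+ h :* x :+ e) :+ x :* (y :* z :^ 2 :+ h :* y :+ e)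
             :+ y :* (z :* x :^ 2 :+ h :* z :+ e) :+ (x :+ y :+ z) :* (x :* y :* z :+ con 1)) x y z h e)
        (+-≈0 (+-≈0 (+-≈0 (*-≈0 t₁) (*-≈0 t₂)) (*-≈0 t₃)) (multiple xyz≈1))
      quadratic : h ^ 2 + h * s₂ + e * s₁ ≈ 0#
      quadratic = *-cancelˡ-≈0 (*-≉0 e≉0 h≉0) (trans
        (solve₂ 5 (λ x y z h e →
          e :* h :* (h :^ 2 :+ h :* (x :* y :+ y :* z :+ z :* x) :+ e :* (x :+ y :+ z))
          := x :* z :* h :^ 2 :* (x :* y :^ 2 :+ h :* x :+ e)
             :+ (x :* h :* e :+ x :* h) :* (y :* z :^ 2 :+ h :* y :+ e)
             :+ (y :* h :* e :+ h :^ 3) :* (z :* x :^ 2 :+ h :* z :+ e)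
             :+ (x :* y :* h :^ 2 :+ x :* h :* e :+ z :* h :* e :+ z :* h) :* (x :* y :* z :+ con 1)
             :+ z :* h :* (h :^ 3 :+ (e :^ 2 :+ e :+ con 1))) x y z h e)
        (+-≈0 (+-≈0 (+-≈0 (+-≈0 (*-≈0 t₁) (*-≈0 t₂)) (*-≈0 t₃)) (multiple xyz≈1)) (multiple h³≈e²+e+1)))
      s₁≈h² : s₁ ≈ h ^ 2
      s₁≈h² = +≈0⇒≈ (trans
        (solve₂ 4 (λ s₁ s₂ h e → s₁ :+ h :^ 2
                     := ((e :+ con 1) :* s₁ :+ h :* s₂) :+ (h :^ 2 :+ h :* s₂ :+ e :* s₁)) s₁ s₂ h e)
        (+-≈0 linear quadratic))
      s₂≈[e+1]h : s₂ ≈ (e + 1#) * h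
      s₂≈[e+1]h = +≈0⇒≈ (*-cancelˡ-≈0 h≉0 (trans
        (solve₂ 4 (λ s₁ s₂ h e → h :* (s₂ :+ (e :+ con 1) :* h)
                     := ((e :+ con 1) :* s₁ :+ h :* s₂) :+ (e :+ con 1) :* (s₁ :+ h :^ 2)) s₁ s₂ h e)
        (+-≈0 linear (multiple s₁≈h²))))

  module Frobenius (A : IsAlgClosureF2 R) (m : ℕ) {h e : Carrier}
                   (σh≈h : h ^ (2 ^ℕ m) ≈ h) (h≉0 : ¬ h ≈ 0#)
                   (σe≈e : e ^ (2 ^ℕ m) ≈ e) (e≉0 : ¬ e ≈ 0#)
                   (h³≈e²+e+1 : h ^ 3 ≈ e ^ 2 + e + 1#) where

    open IsAlgClosureF2 A
    open Char2 char2
    open Char2Field char2 inverses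
    open AlgebraicOverF₂ A
    open PowersOfTwo char2
    open CyclicSystem char2 inverses h≉0 e≉0 h³≈e²+e+1
    open import Relation.Binary.Reasoning.Setoid setoid

    q : ℕ
    q = 2 ^ℕ m

    σ : Carrier → Carrier
    σ x = x ^ q

    σ-cong : ∀ {x y} → x ≈ y → σ x ≈ σ y
    σ-cong = ^-congˡ q

    σ-0 : σ 0# ≈ 0#
    σ-0 = trans (^-congʳ 0# (≡.sym (ℕ.suc-pred q {{ℕ.m^n≢0 2 m}}))) (zeroˡ _)

    σ-+ : ∀ x y → σ (x + y) ≈ σ x + σ y
    σ-+ = ^2^-distrib-+ m

    σ-* : ∀ x y → σ (x * y) ≈ σ x * σ y
    σ-* x y = ^-distrib-* x y q

    σ-^ : ∀ x n → σ (x ^ n) ≈ σ x ^ n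
    σ-^ x n = begin
      (x ^ n) ^ q    ≈⟨ ^-assocʳ x n q ⟩
      x ^ (n *ℕ q)   ≈⟨ ^-congʳ x (ℕ.*-comm n q) ⟩
      x ^ (q *ℕ n)   ≈⟨ ^-assocʳ x q n ⟨
      (x ^ q) ^ n    ∎

    σ-on-cube-roots-of-unity : (∀ t → t ^ 3 ≈ 1# → σ t ≈ t) ⊎ (∀ t → t ^ 3 ≈ 1# → σ t ≈ t ^ 2)
    σ-on-cube-roots-of-unity = ^2^-on-cube-roots-of-unity m

    σσ-fixes-cube-roots-of-unity : ∀ {t} → t ^ 3 ≈ 1# → σ (σ t) ≈ t
    σσ-fixes-cube-roots-of-unity {t} t³≈1 =
      [ (λ fixes → trans (σ-cong (fixes t t³≈1)) (fixes t t³≈1))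
      , (λ squares → begin
           σ (σ t)       ≈⟨ σ-cong (squares t t³≈1) ⟩
           σ (t ^ 2)     ≈⟨ σ-^ t 2 ⟩
           σ t ^ 2       ≈⟨ ^-congˡ 2 (squares t t³≈1) ⟩
           (t ^ 2) ^ 2   ≈⟨ modulo (solve₂ 1 (λ t → (t :^ 2) :^ 2 := t :+ t :* (t :^ 3 :+ con 1)) t) (multiple t³≈1) ⟩
           t             ∎)
      ]′ σ-on-cube-roots-of-unity

    σ-twisted : ∀ {x y} → twisted h e x y ≈ 0# → twisted h e (σ x) (σ y) ≈ 0#
    σ-twisted {x} {y} t≈0 = begin
      σ x * σ y ^ 2 + h * σ x + e        ≈⟨ +-cong (+-cong (*-congˡ (σ-^ y 2)) (*-congʳ σh≈h)) σe≈e ⟨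
      σ x * σ (y ^ 2) + σ h * σ x + σ e  ≈⟨ +-congʳ (+-cong (σ-* x (y ^ 2)) (σ-* h x)) ⟨
      σ (x * y ^ 2) + σ (h * x) + σ e    ≈⟨ +-congʳ (σ-+ _ _) ⟨
      σ (x * y ^ 2 + h * x) + σ e        ≈⟨ σ-+ _ _ ⟨
      σ (twisted h e x y)                ≈⟨ σ-cong t≈0 ⟩
      σ 0#                               ≈⟨ σ-0 ⟩
      0#                                 ∎

    InMu : Carrier → Set ℓ
    InMu x = σ (σ x) * σ x * x ≈ 1#

    σ³≈id : ∀ {x} → InMu x → σ (σ (σ x)) ≈ x
    σ³≈id {x} x∈μ = begin
      σ (σ (σ x))                                     ≈⟨ *-identityʳ _ ⟨
      σ (σ (σ x)) * 1#                                ≈⟨ *-congˡ x∈μ ⟨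
      σ (σ (σ x)) * (σ (σ x) * σ x * x)               ≈⟨ solve₂ 4 (λ a b c d → a :* (b :* c :* d) := d :* (a :* b :* c)) _ _ _ _ ⟩
      x * (σ (σ (σ x)) * σ (σ x) * σ x)               ≈⟨ *-congˡ σx∈μ ⟩
      x * 1#                                          ≈⟨ *-identityʳ x ⟩
      x                                               ∎
      where
      σx∈μ : σ (σ (σ x)) * σ (σ x) * σ x ≈ 1#
      σx∈μ = begin
        σ (σ (σ x)) * σ (σ x) * σ x       ≈⟨ *-congʳ (σ-* _ _) ⟨
        σ (σ (σ x) * σ x) * σ x           ≈⟨ σ-* _ _ ⟨
        σ (σ (σ x) * σ x * x)             ≈⟨ σ-cong x∈μ ⟩
        σ 1#                              ≈⟨ 1#^ q ⟩
        1#                                ∎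

    σ^ : OneOrTwo → Carrier → Carrier
    σ^ one x = σ x
    σ^ two x = σ (σ x)

    Solution : OneOrTwo → Carrier → Set ℓ
    Solution l x = InMu x × twisted h e x (σ^ l x) ≈ 0#

    solution-is-cubic-root : ∀ l {x} → Solution l x → cubic h e x ≈ 0#
    solution-is-cubic-root one {x} (x∈μ , t) = cyclic-solution-is-root t (σ-twisted t)
      (trans (twisted-cong refl (sym (σ³≈id x∈μ))) (σ-twisted (σ-twisted t)))
      (trans (solve₂ 3 (λ a b c → a :* b :* c := c :* b :* a) _ _ _) x∈μ)
    solution-is-cubic-root two {x} (x∈μ , t) = cyclic-solution-is-root t (σ-twisted t⁻)
      t⁻ (trans (solve₂ 3 (λ a b c → a :* c :* b := c :* b :* a) _ _ _) x∈μ)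
      where
      t⁻ : twisted h e (σ x) x ≈ 0#
      t⁻ = trans (twisted-cong refl (sym (σ³≈id x∈μ))) (σ-twisted t)

    fixed-point-is-not-solution : ∀ {x} → InMu x → σ x ≈ x → twisted h e x x ≈ 0# → ⊥
    fixed-point-is-not-solution {x} x∈μ σx≈x t = ^-≉0 e≉0 3 (trans
      (solve₂ 3 (λ x h e →
        let Q = h :^ 2 :* x :^ 2 :+ h :* x :* (e :+ con 1) :+ (e :+ con 1) :^ 2 in
        e :^ 3 := Q :* (x :* x :^ 2 :+ h :* x :+ e) :+ (Q :+ h :^ 3) :* (x :^ 3 :+ con 1)
                  :+ con 1 :* (h :^ 3 :+ (e :^ 2 :+ e :+ con 1))) x h e)
      (+-≈0 (+-≈0 (*-≈0 t) (multiple x³≈1)) (multiple h³≈e²+e+1)))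
      where
      x³≈1 : x ^ 3 ≈ 1#
      x³≈1 = begin
        x ^ 3               ≈⟨ solve₂ 1 (λ x → x :^ 3 := x :* x :* x) x ⟩
        x * x * x           ≈⟨ *-congʳ (*-cong (trans (σ-cong σx≈x) σx≈x) σx≈x) ⟨
        σ (σ x) * σ x * x   ≈⟨ x∈μ ⟩
        1#                  ∎

    μ-≉0 : ∀ {x} → InMu x → ¬ x ≈ 0#
    μ-≉0 {x} x∈μ x≈0 = h≉0 (begin
      h                          ≈⟨ *-identityʳ h ⟨
      h * 1#                     ≈⟨ *-congˡ x∈μ ⟨
      h * (σ (σ x) * σ x * x)    ≈⟨ *-≈0 (*-≈0 x≈0) ⟩
      0#                         ∎)

    σ^-cong : ∀ l {x y} → x ≈ y → σ^ l x ≈ σ^ l y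
    σ^-cong one x≈y = σ-cong x≈y
    σ^-cong two x≈y = σ-cong (σ-cong x≈y)

    Solution-resp : ∀ l {x y} → x ≈ y → Solution l y → Solution l x
    Solution-resp l x≈y (y∈μ , t) =
      trans (*-cong (*-cong (σ-cong (σ-cong x≈y)) (σ-cong x≈y)) x≈y) y∈μ ,
      trans (twisted-cong x≈y (σ^-cong l x≈y)) t

    no-common-solution : ∀ {x} → Solution one x → Solution two x → ⊥
    no-common-solution {x} (x∈μ , t₁) (_ , t₂) =
      fixed-point-is-not-solution x∈μ σx≈x (trans (twisted-cong refl (sym σx≈x)) t₁)
      where
      σx≈σσx : σ x ≈ σ (σ x)
      σx≈σσx = +≈0⇒≈ (x*x≈0⇒x≈0 (*-cancelˡ-≈0 (μ-≉0 x∈μ) (trans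
        (solve₂ 5 (λ x a b h e → x :* ((a :+ b) :* (a :+ b))
                    := (x :* a :^ 2 :+ h :* x :+ e) :+ (x :* b :^ 2 :+ h :* x :+ e)) x (σ x) (σ (σ x)) h e)
        (+-≈0 t₁ t₂))))
      σx≈x : σ x ≈ x
      σx≈x = trans σx≈σσx (trans (σ-cong σx≈σσx) (σ³≈id x∈μ))

  module Corollary (A : IsAlgClosureF2 R) (m : ℕ) {ω h e : Carrier}
                   (ω⁴≈ω : ω ^ 4 ≈ ω) (ω≉0 : ¬ ω ≈ 0#) (ω≉1 : ¬ ω ≈ 1#)
                   (σh≈h : h ^ (2 ^ℕ m) ≈ h) (h≉0 : ¬ h ≈ 0#)
                   (σe≈e : e ^ (2 ^ℕ m) ≈ e) (e≉0 : ¬ e ≈ 0#)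
                   (h³≈e²+e+1 : h ^ 3 ≈ e ^ 2 + e + 1#) where

    open IsAlgClosureF2 A
    open Char2 char2
    open Char2Field char2 inverses
    open AlgebraicOverF₂ A
    open Frobenius A m σh≈h h≉0 σe≈e e≉0 h³≈e²+e+1
    open import Relation.Binary.Reasoning.Setoid setoid

    ω²+ω+1≈0 : ω ^ 2 + ω + 1# ≈ 0#
    ω²+ω+1≈0 = primitive-cube-root ω⁴≈ω ω≉0 ω≉1

    open PrimitiveCubeRoot char2 ω²+ω+1≈0

    cube-root-of-unity-cases : ∀ {t} → t ^ 3 ≈ 1# → ¬ ¬ (t ≈ 1# ⊎ t ≈ ω ⊎ t ≈ ω ^ 2)
    cube-root-of-unity-cases {t} t³≈1 k = *₃≈0⇒¬¬ (trans (sym (cube-roots-of-unity t)) (≈⇒+≈0 t³≈1)) λ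
      { (inj₁ z) → k (inj₁ (+≈0⇒≈ z))
      ; (inj₂ (inj₁ z)) → k (inj₂ (inj₁ (+≈0⇒≈ z)))
      ; (inj₂ (inj₂ z)) → k (inj₂ (inj₂ (+≈0⇒≈ z))) }

    U : Carrier
    U = proj₁ (cube-root (e + ω))

    U³≈e+ω : U ^ 3 ≈ e + ω
    U³≈e+ω = proj₂ (cube-root (e + ω))

    e+ω≉0 : ¬ e + ω ≈ 0#
    e+ω≉0 e+ω≈0 = ^-≉0 h≉0 3 (begin
      h ^ 3                   ≈⟨ h³≈e²+e+1 ⟩
      e ^ 2 + e + 1#          ≈⟨ norm e ⟨
      (e + ω) * (e + ω ^ 2)   ≈⟨ trans (*-congʳ e+ω≈0) (zeroˡ _) ⟩
      0#                      ∎)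

    U≉0 : ¬ U ≈ 0#
    U≉0 U≈0 = e+ω≉0 (trans (sym U³≈e+ω) (trans (^-congˡ 3 U≈0) (zeroˡ _)))

    V : Carrier
    V = h * proj₁ (inverses U U≉0)

    UV≈h : U * V ≈ h
    UV≈h = begin
      U * (h * U⁻¹)   ≈⟨ solve₂ 3 (λ U h W → U :* (h :* W) := h :* (U :* W)) U h U⁻¹ ⟩
      h * (U * U⁻¹)   ≈⟨ *-congˡ (proj₂ (inverses U U≉0)) ⟩
      h * 1#          ≈⟨ *-identityʳ h ⟩
      h               ∎
      where U⁻¹ = proj₁ (inverses U U≉0)

    V≉0 : ¬ V ≈ 0#
    V≉0 V≈0 = h≉0 (trans (sym UV≈h) (*-≈0 V≈0))

    V³≈e+ω² : V ^ 3 ≈ e + ω ^ 2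
    V³≈e+ω² = *-cancelˡ e+ω≉0 (begin
      (e + ω) * V ^ 3         ≈⟨ *-congʳ U³≈e+ω ⟨
      U ^ 3 * V ^ 3           ≈⟨ ^-distrib-* U V 3 ⟨
      (U * V) ^ 3             ≈⟨ ^-congˡ 3 UV≈h ⟩
      h ^ 3                   ≈⟨ h³≈e²+e+1 ⟩
      e ^ 2 + e + 1#          ≈⟨ norm e ⟨
      (e + ω) * (e + ω ^ 2)   ∎)

    open CardanoRoots char2 ω²+ω+1≈0 UV≈h U³≈e+ω V³≈e+ω²

    σ-root : ∀ b → σ (root b) ≈ e * (σ b * σ U + σ b ^ 2 * σ V) + h ^ 2
    σ-root b = begin
      σ (e * (b * U + b ^ 2 * V) + h ^ 2)          ≈⟨ σ-+ _ _ ⟩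
      σ (e * (b * U + b ^ 2 * V)) + σ (h ^ 2)      ≈⟨ +-cong (σ-* _ _) (σ-^ h 2) ⟩
      σ e * σ (b * U + b ^ 2 * V) + σ h ^ 2        ≈⟨ +-cong (*-cong σe≈e (σ-+ _ _)) (^-congˡ 2 σh≈h) ⟩
      e * (σ (b * U) + σ (b ^ 2 * V)) + h ^ 2      ≈⟨ +-congʳ (*-congˡ (+-cong (σ-* b U) (trans (σ-* _ V) (*-congʳ (σ-^ b 2))))) ⟩
      e * (σ b * σ U + σ b ^ 2 * σ V) + h ^ 2      ∎

    σU*σV≈UV : σ U * σ V ≈ U * V
    σU*σV≈UV = trans (sym (σ-* U V)) (trans (σ-cong UV≈h) (trans σh≈h (sym UV≈h)))

    σU³≈e+σω : σ U ^ 3 ≈ e + σ ω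
    σU³≈e+σω = trans (sym (σ-^ U 3)) (trans (σ-cong U³≈e+ω) (trans (σ-+ e ω) (+-congʳ σe≈e)))

    -- σ U is t U or t V for a cube root of unity t, according as σ fixes ω or squares it;
    -- the shift hypothesis σ² U · a = U identifies t with a or with a².
    permutes-roots-when-ω-fixed : (∀ t → t ^ 3 ≈ 1# → σ t ≈ t) →
      ∀ {a} → a ^ 3 ≈ 1# → σ (σ U) * a ≈ U → ∀ {b} → b ^ 3 ≈ 1# → σ (root b) ≈ root (a * b)
    permutes-roots-when-ω-fixed fixes {a} a³≈1 shift {b} b³≈1 = begin
      σ (root b)                                        ≈⟨ σ-root b ⟩
      e * (σ b * σ U + σ b ^ 2 * σ V) + h ^ 2           ≈⟨ +-congʳ (*-congˡ (+-cong (*-cong σb≈b σU≈tU)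
                                                             (*-cong (^-congˡ 2 σb≈b) σV≈t²V))) ⟩
      e * (b * (t * U) + b ^ 2 * (t ^ 2 * V)) + h ^ 2   ≈⟨ modulo (solve₂ 7 (λ a b t e h U V →
                                                             e :* (b :* (t :* U) :+ b :^ 2 :* (t :^ 2 :* V)) :+ h :^ 2
                                                             := e :* (a :* b :* U :+ (a :* b) :^ 2 :* V) :+ h :^ 2
                                                                :+ (e :* U :* b :+ e :* V :* b :^ 2 :* (t :+ a)) :* (t :+ a))
                                                             a b t e h U V) (multiple t≈a) ⟩
      root (a * b)                                      ∎
      where
      ratio : ∃ λ t → t ^ 3 ≈ 1# × σ U ≈ t * U
      ratio = equal-cubes U≉0 (trans σU³≈e+σω (trans (+-congˡ (fixes ω ω³≈1)) (sym U³≈e+ω)))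
      t : Carrier
      t = proj₁ ratio
      t³≈1 : t ^ 3 ≈ 1#
      t³≈1 = proj₁ (proj₂ ratio)
      σU≈tU : σ U ≈ t * U
      σU≈tU = proj₂ (proj₂ ratio)
      σb≈b : σ b ≈ b
      σb≈b = fixes b b³≈1
      σV≈t²V : σ V ≈ t ^ 2 * V
      σV≈t²V = cube-root-of-unity-inverse t³≈1 (*-cancelˡ U≉0 (begin
        U * (t * σ V)   ≈⟨ solve₂ 3 (λ t U x → U :* (t :* x) := t :* U :* x) t U (σ V) ⟩
        t * U * σ V     ≈⟨ *-congʳ σU≈tU ⟨
        σ U * σ V       ≈⟨ σU*σV≈UV ⟩
        U * V           ∎))
      t≈a : t ≈ a
      t≈a = modulo (solve₂ 2 (λ t a → t := a :+ (t :* (t :^ 2 :* a :+ con 1) :+ a :* (t :^ 3 :+ con 1))) t a)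
        (+-≈0 (multiple (*-cancelˡ U≉0 (trans (solve₂ 3 (λ t a U → U :* (t :^ 2 :* a) := t :* (t :* U) :* a) t a U)
                                            (trans (*-congʳ (sym σσU≈t[tU])) (trans shift (sym (*-identityʳ U)))))))
              (multiple t³≈1))
        where
        σσU≈t[tU] : σ (σ U) ≈ t * (t * U)
        σσU≈t[tU] = trans (σ-cong σU≈tU) (trans (σ-* t U) (*-cong (fixes t t³≈1) σU≈tU))

    permutes-roots-when-ω-squared : (∀ t → t ^ 3 ≈ 1# → σ t ≈ t ^ 2) →
      ∀ {a} → a ^ 3 ≈ 1# → σ (σ U) * a ≈ U → ∀ {b} → b ^ 3 ≈ 1# → σ (root b) ≈ root (a * b)
    permutes-roots-when-ω-squared squares {a} a³≈1 shift {b} b³≈1 = begin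
      σ (root b)                                               ≈⟨ σ-root b ⟩
      e * (σ b * σ U + σ b ^ 2 * σ V) + h ^ 2                  ≈⟨ +-congʳ (*-congˡ (+-cong (*-cong σb≈b² σU≈tV)
                                                                    (*-cong (^-congˡ 2 σb≈b²) σV≈t²U))) ⟩
      e * (b ^ 2 * (t * V) + (b ^ 2) ^ 2 * (t ^ 2 * U)) + h ^ 2 ≈⟨ modulo (solve₂ 7 (λ a b t e h U V →
                                                                    e :* (b :^ 2 :* (t :* V) :+ (b :^ 2) :^ 2 :* (t :^ 2 :* U)) :+ h :^ 2
                                                                    := e :* (a :* b :* U :+ (a :* b) :^ 2 :* V) :+ h :^ 2
                                                                       :+ ((e :* b :^ 2 :* V :+ e :* (b :^ 2) :^ 2 :* U :* (t :+ a :^ 2))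
                                                                             :* (t :+ a :^ 2)
                                                                           :+ e :* U :* a :* b :* b :^ 3 :* (a :^ 3 :+ con 1)
                                                                           :+ e :* U :* a :* b :* (b :^ 3 :+ con 1)))
                                                                    a b t e h U V)
                                                                  (+-≈0 (+-≈0 (multiple t≈a²) (multiple a³≈1)) (multiple b³≈1)) ⟩
      root (a * b)                                             ∎
      where
      ratio : ∃ λ t → t ^ 3 ≈ 1# × σ U ≈ t * V
      ratio = equal-cubes V≉0 (trans σU³≈e+σω (trans (+-congˡ (squares ω ω³≈1)) (sym V³≈e+ω²)))
      t : Carrier
      t = proj₁ ratio
      t³≈1 : t ^ 3 ≈ 1#
      t³≈1 = proj₁ (proj₂ ratio)
      σU≈tV : σ U ≈ t * V
      σU≈tV = proj₂ (proj₂ ratio)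
      σb≈b² : σ b ≈ b ^ 2
      σb≈b² = squares b b³≈1
      σV≈t²U : σ V ≈ t ^ 2 * U
      σV≈t²U = cube-root-of-unity-inverse t³≈1 (*-cancelˡ V≉0 (begin
        V * (t * σ V)   ≈⟨ solve₂ 3 (λ t V x → V :* (t :* x) := t :* V :* x) t V (σ V) ⟩
        t * V * σ V     ≈⟨ *-congʳ σU≈tV ⟨
        σ U * σ V       ≈⟨ σU*σV≈UV ⟩
        U * V           ≈⟨ *-comm U V ⟩
        V * U           ∎))
      t≈a² : t ≈ a ^ 2
      t≈a² = modulo (solve₂ 2 (λ t a → t := a :^ 2 :+ (a :^ 2 :* (t :^ 4 :* a :+ con 1) :+ t :^ 4 :* (a :^ 3 :+ con 1)
                                                       :+ t :* (t :^ 3 :+ con 1))) t a)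
        (+-≈0 (+-≈0 (multiple (*-cancelˡ U≉0 (trans (solve₂ 3 (λ t a U → U :* (t :^ 4 :* a) := t :^ 2 :* (t :^ 2 :* U) :* a) t a U)
                                                   (trans (*-congʳ (sym σσU≈t²[t²U])) (trans shift (sym (*-identityʳ U)))))))
                    (multiple a³≈1))
              (multiple t³≈1))
        where
        σσU≈t²[t²U] : σ (σ U) ≈ t ^ 2 * (t ^ 2 * U)
        σσU≈t²[t²U] = trans (σ-cong σU≈tV) (trans (σ-* t V) (*-cong (squares t t³≈1) σV≈t²U))

    frobenius-permutes-roots : ∀ {a} → a ^ 3 ≈ 1# → σ (σ U) * a ≈ U →
                               ∀ {b} → b ^ 3 ≈ 1# → σ (root b) ≈ root (a * b)
    frobenius-permutes-roots =
      [ permutes-roots-when-ω-fixed , permutes-roots-when-ω-squared ]′ σ-on-cube-roots-of-unity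

    module Rotated {b} (b³≈1 : b ^ 3 ≈ 1#) =
      CardanoRoots char2 ω²+ω+1≈0 (rotated-UV≈h b³≈1) (rotated-U³ b³≈1) (rotated-V³ b³≈1)

    product-of-rotated-roots : ∀ {a b} → a ^ 2 + a + 1# ≈ 0# → b ^ 3 ≈ 1# →
                               root b * root (a * b) * root (a ^ 2 * b) ≈ 1#
    product-of-rotated-roots {a} {b} a²+a+1≈0 b³≈1 = begin
      root b * root (a * b) * root (a ^ 2 * b)
        ≈⟨ *-cong (*-cong (trans (root-cong (sym (*-identityˡ b))) (rotated 1#)) (rotated a)) (rotated (a ^ 2)) ⟩
      (0# + R.root 1#) * (0# + R.root a) * (0# + R.root (a ^ 2))
        ≈⟨ R.cubic-factorisation a²+a+1≈0 0# ⟨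
      cubic h e 0#
        ≈⟨ solve₂ 2 (λ h e → con 0 :^ 3 :+ h :^ 2 :* con 0 :^ 2 :+ (e :+ con 1) :* h :* con 0 :+ con 1 := con 1) h e ⟩
      1# ∎
      where
      module R = Rotated b³≈1
      rotated : ∀ c → root (c * b) ≈ 0# + R.root c
      rotated c = trans (sym (root-of-rotated b c)) (sym (+-identityˡ _))

    twisted-rotated : ∀ {b} → b ^ 3 ≈ 1# → twisted h e (root b) (root (ω * b)) ≈ 0#
    twisted-rotated {b} b³≈1 = trans
      (twisted-cong (trans (root-cong (sym (*-identityˡ b))) (sym (root-of-rotated b 1#)))
                    (sym (root-of-rotated b ω)))
      R.twisted-root
      where
      module R = Rotated b³≈1

    shift : OneOrTwo → Carrier
    shift l = ω ^ toℕ l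

    shift³≈1 : ∀ l → shift l ^ 3 ≈ 1#
    shift³≈1 one = modulo (solve₂ 1 (λ ω → (ω :* con 1) :^ 3 := con 1 :+ con 1 :* (ω :^ 3 :+ con 1)) ω) (multiple ω³≈1)
    shift³≈1 two = modulo (solve₂ 1 (λ ω → (ω :* (ω :* con 1)) :^ 3 := con 1 :+ (ω :^ 3 :+ con 1) :* (ω :^ 3 :+ con 1)) ω)
                          (multiple ω³≈1)

    shift-primitive : ∀ l → shift l ^ 2 + shift l + 1# ≈ 0#
    shift-primitive one = trans (solve₂ 1 (λ ω → (ω :* con 1) :^ 2 :+ ω :* con 1 :+ con 1 := ω :^ 2 :+ ω :+ con 1) ω) ω²+ω+1≈0
    shift-primitive two = trans (solve₂ 1 (λ ω → (ω :* (ω :* con 1)) :^ 2 :+ ω :* (ω :* con 1) :+ con 1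
                                               := (ω :^ 2 :+ ω :+ con 1) :* (ω :^ 2 :+ ω :+ con 1)) ω) (*-≈0 ω²+ω+1≈0)

    σ^-root : ∀ l → σ (σ U) * shift l ≈ U → ∀ {b} → b ^ 3 ≈ 1# → σ^ l (root b) ≈ root (ω * b)
    σ^-root one shifted b³≈1 =
      trans (frobenius-permutes-roots (shift³≈1 one) shifted b³≈1) (root-cong (*-congʳ (*-identityʳ ω)))
    σ^-root two shifted {b} b³≈1 =
      trans (σ-cong (permutes b³≈1)) (trans (permutes (cube-of-product (shift³≈1 two) b³≈1)) (root-cong ω²[ω²b]≈ωb))
      where
      permutes : ∀ {c} → c ^ 3 ≈ 1# → σ (root c) ≈ root (shift two * c)
      permutes = frobenius-permutes-roots (shift³≈1 two) shifted
      ω²[ω²b]≈ωb : shift two * (shift two * b) ≈ ω * b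
      ω²[ω²b]≈ωb = modulo (solve₂ 2 (λ ω b → ω :* (ω :* con 1) :* (ω :* (ω :* con 1) :* b)
                                            := ω :* b :+ b :* (ω :^ 4 :+ ω)) ω b) (multiple ω⁴≈ω)

    cardano-root-is-solution : ∀ l → σ (σ U) * shift l ≈ U → ∀ {b} → b ^ 3 ≈ 1# → Solution l (root b)
    cardano-root-is-solution l shifted {b} b³≈1 =
      root-b∈μ , trans (twisted-cong refl (σ^-root l shifted b³≈1)) (twisted-rotated b³≈1)
      where
      a : Carrier
      a = shift l
      permutes : ∀ {c} → c ^ 3 ≈ 1# → σ (root c) ≈ root (a * c)
      permutes = frobenius-permutes-roots (shift³≈1 l) shifted
      root-b∈μ : InMu (root b)
      root-b∈μ = begin
        σ (σ (root b)) * σ (root b) * root b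
          ≈⟨ *-congʳ (*-cong (trans (σ-cong (permutes b³≈1)) (permutes (cube-of-product (shift³≈1 l) b³≈1)))
                             (permutes b³≈1)) ⟩
        root (a * (a * b)) * root (a * b) * root b
          ≈⟨ *-congʳ (*-congʳ (root-cong (solve₂ 2 (λ a b → a :* (a :* b) := a :^ 2 :* b) a b))) ⟩
        root (a ^ 2 * b) * root (a * b) * root b
          ≈⟨ solve₂ 3 (λ x y z → x :* y :* z := z :* y :* x) _ _ _ ⟩
        root b * root (a * b) * root (a ^ 2 * b)
          ≈⟨ product-of-rotated-roots (shift-primitive l) b³≈1 ⟩
        1# ∎

    roots-of-cubic : ∀ {x} → cubic h e x ≈ 0# → ¬ ¬ (∃ λ b → b ^ 3 ≈ 1# × x ≈ root b)
    roots-of-cubic {x} x-root k = *₃≈0⇒¬¬ (trans (sym (cubic-factorisation ω²+ω+1≈0 x)) x-root) λ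
      { (inj₁ z) → k (1# , 1#^ 3 , +≈0⇒≈ z)
      ; (inj₂ (inj₁ z)) → k (ω , ω³≈1 , +≈0⇒≈ z)
      ; (inj₂ (inj₂ z)) → k (ω ^ 2 , shift³≈1 two , +≈0⇒≈ z) }

    σσU-shift : ∃ λ a → a ^ 3 ≈ 1# × σ (σ U) * a ≈ U
    σσU-shift = t ^ 2 , t⁶≈1 , σσU*t²≈U
      where
      ratio : ∃ λ t → t ^ 3 ≈ 1# × σ (σ U) ≈ t * U
      ratio = equal-cubes U≉0 (begin
        σ (σ U) ^ 3      ≈⟨ trans (σ-cong (σ-^ U 3)) (σ-^ (σ U) 3) ⟨
        σ (σ (U ^ 3))    ≈⟨ σ-cong (σ-cong U³≈e+ω) ⟩
        σ (σ (e + ω))    ≈⟨ trans (σ-cong (σ-+ e ω)) (σ-+ (σ e) (σ ω)) ⟩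
        σ (σ e) + σ (σ ω) ≈⟨ +-cong (trans (σ-cong σe≈e) σe≈e) (σσ-fixes-cube-roots-of-unity ω³≈1) ⟩
        e + ω            ≈⟨ U³≈e+ω ⟨
        U ^ 3            ∎)
      t : Carrier
      t = proj₁ ratio
      t³≈1 : t ^ 3 ≈ 1#
      t³≈1 = proj₁ (proj₂ ratio)
      t⁶≈1 : (t ^ 2) ^ 3 ≈ 1#
      t⁶≈1 = modulo (solve₂ 1 (λ t → (t :^ 2) :^ 3 := con 1 :+ (t :^ 3 :+ con 1) :* (t :^ 3 :+ con 1)) t) (multiple t³≈1)
      σσU*t²≈U : σ (σ U) * t ^ 2 ≈ U
      σσU*t²≈U = begin
        σ (σ U) * t ^ 2     ≈⟨ *-congʳ (proj₂ (proj₂ ratio)) ⟩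
        t * U * t ^ 2       ≈⟨ modulo (solve₂ 2 (λ t U → t :* U :* t :^ 2 := U :+ U :* (t :^ 3 :+ con 1)) t U) (multiple t³≈1) ⟩
        U                   ∎

    σ^-fixed : ∀ l {x} → σ x ≈ x → σ^ l x ≈ x
    σ^-fixed one σx≈x = σx≈x
    σ^-fixed two σx≈x = trans (σ-cong σx≈x) σx≈x

    shift-by : ∀ {a a′} → σ (σ U) * a ≈ U → a ≈ a′ → σ (σ U) * a′ ≈ U
    shift-by shifted a≈a′ = trans (*-congˡ (sym a≈a′)) shifted

    ω≈shift-one : ω ≈ shift one
    ω≈shift-one = sym (*-identityʳ ω)

    shift-of-solution : ∀ l {x a b} → Solution l x → x ≈ root b → b ^ 3 ≈ 1# → σ (σ U) * a ≈ U →
                        a ≈ 1# ⊎ a ≈ ω ⊎ a ≈ ω ^ 2 → σ (σ U) * shift l ≈ U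
    shift-of-solution l {x} {a} {b} (x∈μ , t) x≈root-b b³≈1 shifted (inj₁ a≈1) =
      ⊥-elim (fixed-point-is-not-solution x∈μ σx≈x (trans (twisted-cong refl (sym (σ^-fixed l σx≈x))) t))
      where
      σx≈x : σ x ≈ x
      σx≈x = begin
        σ x             ≈⟨ σ-cong x≈root-b ⟩
        σ (root b)      ≈⟨ frobenius-permutes-roots (trans (^-congˡ 3 a≈1) (1#^ 3)) shifted b³≈1 ⟩
        root (a * b)    ≈⟨ root-cong (trans (*-congʳ a≈1) (*-identityˡ b)) ⟩
        root b          ≈⟨ x≈root-b ⟨
        x               ∎
    shift-of-solution one _ _ _ shifted (inj₂ (inj₁ a≈ω))  = shift-by shifted (trans a≈ω ω≈shift-one)
    shift-of-solution two _ _ _ shifted (inj₂ (inj₂ a≈ω²)) = shift-by shifted a≈ω²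
    shift-of-solution one solution x≈root-b b³≈1 shifted (inj₂ (inj₂ a≈ω²)) =
      ⊥-elim (no-common-solution solution
        (Solution-resp two x≈root-b (cardano-root-is-solution two (shift-by shifted a≈ω²) b³≈1)))
    shift-of-solution two solution x≈root-b b³≈1 shifted (inj₂ (inj₁ a≈ω)) =
      ⊥-elim (no-common-solution
        (Solution-resp one x≈root-b (cardano-root-is-solution one (shift-by shifted (trans a≈ω ω≈shift-one)) b³≈1))
        solution)

    solution-forces-shift : ∀ l {x} → Solution l x → σ (σ U) * shift l ≈ U
    solution-forces-shift l solution = ≈-stable λ k →
      roots-of-cubic (solution-is-cubic-root l solution) λ (b , b³≈1 , x≈root-b) →
      cube-root-of-unity-cases (proj₁ (proj₂ σσU-shift)) λ cases →
      k (shift-of-solution l solution x≈root-b b³≈1 (proj₂ (proj₂ σσU-shift)) cases)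

    shift⇔condition : ∀ l → σ (σ U) * shift l ≈ U ⇔ (e + ω) ^ ((q *ℕ q ∸ 1) / 3) * shift l ≈ 1#
    shift⇔condition l = mk⇔
      (λ shifted → trans (*-congʳ [e+ω]^K≈P) (*-cancelˡ U≉0 (begin
        U * (P * shift l)       ≈⟨ *-assoc U P (shift l) ⟨
        U * P * shift l         ≈⟨ *-congʳ σσU≈UP ⟨
        σ (σ U) * shift l       ≈⟨ shifted ⟩
        U                       ≈⟨ *-identityʳ U ⟨
        U * 1#                  ∎)))
      (λ condition → begin
        σ (σ U) * shift l                          ≈⟨ *-congʳ σσU≈UP ⟩
        U * P * shift l                            ≈⟨ *-assoc U P (shift l) ⟩
        U * (P * shift l)                          ≈⟨ *-congˡ (*-congʳ [e+ω]^K≈P) ⟨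
        U * ((e + ω) ^ ((q *ℕ q ∸ 1) / 3) * shift l) ≈⟨ *-congˡ condition ⟩
        U * 1#                                     ≈⟨ *-identityʳ U ⟩
        U                                          ∎)
      where
      k : ℕ
      k = proj₁ (2^m*2^m≡1+k*3 m)
      q*q≡1+k*3 : q *ℕ q ≡ ℕ.suc (k *ℕ 3)
      q*q≡1+k*3 = proj₂ (2^m*2^m≡1+k*3 m)
      P : Carrier
      P = U ^ (k *ℕ 3)
      σσU≈UP : σ (σ U) ≈ U * P
      σσU≈UP = trans (^-assocʳ U q q) (^-congʳ U q*q≡1+k*3)
      [e+ω]^K≈P : (e + ω) ^ ((q *ℕ q ∸ 1) / 3) ≈ P
      [e+ω]^K≈P = begin
        (e + ω) ^ ((q *ℕ q ∸ 1) / 3)   ≈⟨ ^-congʳ (e + ω)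
                                             (≡.trans (≡.cong (λ n → (n ∸ 1) / 3) q*q≡1+k*3) (DivMod.m*n/n≡m k 3)) ⟩
        (e + ω) ^ k                     ≈⟨ ^-congˡ k U³≈e+ω ⟨
        (U ^ 3) ^ k                     ≈⟨ ^-assocʳ U 3 k ⟩
        U ^ (3 *ℕ k)                    ≈⟨ ^-congʳ U (ℕ.*-comm 3 k) ⟩
        P                               ∎

    μ-form : ∀ x → x ^ (q *ℕ q +ℕ q +ℕ 1) ≈ σ (σ x) * σ x * x
    μ-form x = begin
      x ^ (q *ℕ q +ℕ q +ℕ 1)        ≈⟨ ^-homo-* x (q *ℕ q +ℕ q) 1 ⟩
      x ^ (q *ℕ q +ℕ q) * x ^ 1     ≈⟨ *-cong (^-homo-* x (q *ℕ q) q) (*-identityʳ x) ⟩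
      x ^ (q *ℕ q) * x ^ q * x      ≈⟨ *-congʳ (*-congʳ (^-assocʳ x q q)) ⟨
      σ (σ x) * σ x * x             ∎

    σ^-form : ∀ l x → x ^ (q ^ℕ toℕ l) ≈ σ^ l x
    σ^-form one x = ^-congʳ x (ℕ.*-identityʳ q)
    σ^-form two x = trans (^-congʳ x (≡.cong (q *ℕ_) (ℕ.*-identityʳ q))) (sym (^-assocʳ x q q))

    equation-form : ∀ l x → x ^ (2 *ℕ q ^ℕ toℕ l +ℕ 1) + h * x + e ≈ twisted h e x (σ^ l x)
    equation-form l x = +-congʳ (+-congʳ (begin
      x ^ (2 *ℕ n +ℕ 1)          ≈⟨ ^-homo-* x (2 *ℕ n) 1 ⟩
      x ^ (2 *ℕ n) * x ^ 1       ≈⟨ *-congʳ (trans (^-congʳ x (ℕ.*-comm 2 n)) (sym (^-assocʳ x n 2))) ⟩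
      (x ^ n) ^ 2 * x ^ 1        ≈⟨ *-congʳ (^-congˡ 2 (σ^-form l x)) ⟩
      σ^ l x ^ 2 * x ^ 1         ≈⟨ solve₂ 2 (λ y x → y :^ 2 :* x :^ 1 := x :* y :^ 2) (σ^ l x) x ⟩
      x * σ^ l x ^ 2             ∎))
      where
      n : ℕ
      n = q ^ℕ toℕ l

    μ-root : OneOrTwo → Carrier → Set ℓ
    μ-root l x = x ^ (q *ℕ q +ℕ q +ℕ 1) ≈ 1# × x ^ (2 *ℕ q ^ℕ toℕ l +ℕ 1) + h * x + e ≈ 0#

    μ-root⇔Solution : ∀ l x → μ-root l x ⇔ Solution l x
    μ-root⇔Solution l x = mk⇔
      (λ (x∈μ , t) → trans (sym (μ-form x)) x∈μ , trans (sym (equation-form l x)) t)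
      (λ (x∈μ , t) → trans (μ-form x) x∈μ , trans (equation-form l x) t)

    Condition : OneOrTwo → Set ℓ
    Condition l = (e + ω) ^ ((q *ℕ q ∸ 1) / 3) * shift l ≈ 1#

    corollary : ∀ l → ((∃ λ x → μ-root l x) ⇔ Condition l)
                    × (Condition l → ∀ x → μ-root l x ⇔ cubic h e x ≈ 0#)
    corollary l = mk⇔ existence-forces-condition condition-gives-root , roots-are-cubic-roots
      where
      open Equivalence
      existence-forces-condition : (∃ λ x → μ-root l x) → Condition l
      existence-forces-condition (x , x-root) =
        to (shift⇔condition l) (solution-forces-shift l (to (μ-root⇔Solution l x) x-root))
      condition-gives-root : Condition l → ∃ λ x → μ-root l x
      condition-gives-root condition = root 1# , from (μ-root⇔Solution l (root 1#))
        (cardano-root-is-solution l (from (shift⇔condition l) condition) (1#^ 3))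
      roots-are-cubic-roots : Condition l → ∀ x → μ-root l x ⇔ cubic h e x ≈ 0#
      roots-are-cubic-roots condition x = mk⇔
        (λ x-root → solution-is-cubic-root l (to (μ-root⇔Solution l x) x-root))
        (λ cubic-root → from (μ-root⇔Solution l x) (stable-solution λ k →
          roots-of-cubic cubic-root λ (b , b³≈1 , x≈root-b) →
          k (Solution-resp l x≈root-b (cardano-root-is-solution l (from (shift⇔condition l) condition) b³≈1))))
        where
        stable-solution : ¬ ¬ Solution l x → Solution l x
        stable-solution ¬¬solution = ≈-stable (λ k → ¬¬solution (λ solution → k (proj₁ solution)))
                                   , ≈-stable (λ k → ¬¬solution (λ solution → k (proj₂ solution)))

corollary1p5 : ∀ {c ℓ} (R : CommutativeRing c ℓ) → IsAlgClosureF2 R →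
  let open CommutativeRing R
      open RingPow R
  in (m : ℕ) → 1 ≤ m →
     (ω h e : Carrier) →
     ω ^ 4 ≈ ω → ¬ (ω ≈ 0#) → ¬ (ω ≈ 1#) →
     h ^ (2 ^ℕ m) ≈ h → ¬ (h ≈ 0#) → ¬ (h ≈ 1#) →
     e ^ (2 ^ℕ m) ≈ e → ¬ (e ≈ 0#) → ¬ (e ≈ 1#) →
     h ^ 3 ≈ e ^ 2 + e + 1# →
     (l : ℕ) → (l ≡ 1 ⊎ l ≡ 2) →
     ((∃ λ x → x ^ ((2 ^ℕ m) *ℕ (2 ^ℕ m) +ℕ (2 ^ℕ m) +ℕ 1) ≈ 1#
               × x ^ (2 *ℕ ((2 ^ℕ m) ^ℕ l) +ℕ 1) + h * x + e ≈ 0#)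
       ⇔ ((e + ω) ^ (((2 ^ℕ m) *ℕ (2 ^ℕ m) ∸ 1) / 3) * ω ^ l ≈ 1#))
     × (((e + ω) ^ (((2 ^ℕ m) *ℕ (2 ^ℕ m) ∸ 1) / 3) * ω ^ l ≈ 1#) →
        ∀ x → ((x ^ ((2 ^ℕ m) *ℕ (2 ^ℕ m) +ℕ (2 ^ℕ m) +ℕ 1) ≈ 1#
                × x ^ (2 *ℕ ((2 ^ℕ m) ^ℕ l) +ℕ 1) + h * x + e ≈ 0#)
               ⇔ (x ^ 3 + h ^ 2 * x ^ 2 + (e + 1#) * h * x + 1# ≈ 0#)))
corollary1p5 R A m _ ω h e ω⁴≈ω ω≉0 ω≉1 σh≈h h≉0 _ σe≈e e≉0 _ h³≈e²+e+1 .1 (inj₁ ≡.refl) =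
  Corollary.corollary R A m ω⁴≈ω ω≉0 ω≉1 σh≈h h≉0 σe≈e e≉0 h³≈e²+e+1 one
corollary1p5 R A m _ ω h e ω⁴≈ω ω≉0 ω≉1 σh≈h h≉0 _ σe≈e e≉0 _ h³≈e²+e+1 .2 (inj₂ ≡.refl) =
  Corollary.corollary R A m ω⁴≈ω ω≉0 ω≉1 σh≈h h≉0 σe≈e e≉0 h³≈e²+e+1 two
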